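{- Let $G=(V,E)$ be a graph, let $k,t\ge 0$ be integers, and let $X\subseteq V$ be a $t$-module of $G$ with $|X|>k+t$. If there exists a set $S$ of at most $k$ pairs of vertices such that $(V,E\,\triangle\, S)$ is a cograph, then the budget of $X$ is at most $t$, i.e. every minimum-size set $S'$ of pairs such that $(V,E\,\triangle\,S')$ is a cograph satisfies $|S'\cap\delta(X)|\le t$.
   Context: A cograph is a graph with no induced path on four vertices. For a set $S$ of pairs of vertices, $(V,E\triangle S)$ is the graph obtained by changing the adjacency of each pair in $S$ (an edge/cograph edit of $G$ by $S$). For $X\subseteq V$, $\delta(X)$ is the set of pairs $xy$ with $x\in X$, $y\notin X$. A module is a set $X$ of vertices all having the same neighborhood in $V\setminus X$. A $t$-module of $G$ is a set $X$ of vertices such that there is a set $T$ of at most $t$ pairs of vertices for which $X$ is a module of $(V,E\triangle T)$. The budget of $X$ is the minimum $b$ such that every minimum cograph edit set $S'$ of $G$ satisfies $|S'\cap\delta(X)|\le b$. -}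

module Defs where

open import Data.Nat using (ℕ; _≤_)
open import Data.Bool using (Bool; true; false; _xor_; not)
open import Data.Fin using (Fin; _<_)
open import Data.Fin.Properties using (_≟_)
open import Data.Fin.Subset using (Subset; _∈_; _∉_)
open import Data.Fin.Subset.Properties using (_∈?_)
open import Data.Product using (_×_; _,_; proj₁; proj₂; ∃)
open import Data.List using (List; length; filterᵇ)
open import Data.Bool.ListAction using (any)
open import Data.List.Relation.Unary.All using (All)
open import Data.List.Relation.Unary.Unique.Propositional using (Unique)
open import Relation.Binary.PropositionalEquality using (_≡_; _≢_)
open import Relation.Nullary using (¬_)
open import Relation.Nullary.Decidable using (⌊_⌋)

record Graph (n : ℕ) : Set where
  field
    adj     : Fin n → Fin n → Bool
    sym     : ∀ i j → adj i j ≡ adj j i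
    irrefl  : ∀ i → adj i i ≡ false
open Graph public

-- An unordered pair {i,j} (i ≠ j) is represented by (i , j) with i < j.
Pair : ℕ → Set
Pair n = Fin n × Fin n

-- A set of pairs of vertices: a duplicate-free list of normalised pairs.
-- Its cardinality is its length.
PairSet : ℕ → Set
PairSet n = List (Pair n)

ValidPairSet : ∀ {n} → PairSet n → Set
ValidPairSet S = All (λ p → proj₁ p < proj₂ p) S × Unique S

inPairs : ∀ {n} → PairSet n → Fin n → Fin n → Bool
inPairs S i j = any (λ p → (⌊ proj₁ p ≟ i ⌋ Data.Bool.∧ ⌊ proj₂ p ≟ j ⌋)
                           Data.Bool.∨ (⌊ proj₁ p ≟ j ⌋ Data.Bool.∧ ⌊ proj₂ p ≟ i ⌋)) S

editAdj : ∀ {n} → Graph n → PairSet n → Fin n → Fin n → Bool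
editAdj G S i j = adj G i j xor inPairs S i j

IsCograph : ∀ {n} → (Fin n → Fin n → Bool) → Set
IsCograph {n} A =
  ∀ (a b c d : Fin n) →
  a ≢ b → a ≢ c → a ≢ d → b ≢ c → b ≢ d → c ≢ d →
  ¬ (A a b ≡ true × A b c ≡ true × A c d ≡ true ×
     A a c ≡ false × A b d ≡ false × A a d ≡ false)

IsCographEdit : ∀ {n} → Graph n → PairSet n → Set
IsCographEdit G S = ValidPairSet S × IsCograph (editAdj G S)

IsMinCographEdit : ∀ {n} → Graph n → PairSet n → Set
IsMinCographEdit G S =
  IsCographEdit G S × (∀ S'' → IsCographEdit G S'' → length S ≤ length S'')

IsModule : ∀ {n} → (Fin n → Fin n → Bool) → Subset n → Set
IsModule A X = ∀ x y z → x ∈ X → y ∈ X → z ∉ X → A x z ≡ A y z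

IsTModule : ∀ {n} → Graph n → ℕ → Subset n → Set
IsTModule G t X =
  ∃ λ (T : PairSet _) → ValidPairSet T × length T ≤ t × IsModule (editAdj G T) X

crossCount : ∀ {n} → Subset n → PairSet n → ℕ
crossCount X S = length (filterᵇ (λ p → ⌊ proj₁ p ∈? X ⌋ xor ⌊ proj₂ p ∈? X ⌋) S)

BudgetAtMost : ∀ {n} → Graph n → Subset n → ℕ → Set
BudgetAtMost G X b = ∀ S' → IsMinCographEdit G S' → crossCount X S' ≤ b

-- Let S' be a minimum edit set and T the edit set making X a module. Together they have at
-- most k + t crossing pairs, so some x ∈ X is an endpoint of none of them. Exchange the
-- crossing part of S' for that of T: the result edits G into the graph obtained from
-- G △ S' by giving every vertex of X the outside neighbourhood of x. There X is a module,
-- and an induced P4 meets a module in 0, 1 or 4 vertices, so collapsing X onto x turns any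
-- induced P4 into one of G △ S'; hence the exchanged set is again a cograph edit set, and
-- minimality of S' bounds its crossing part by that of T, which has at most t pairs.
module Submission where

open import Defs renaming (sym to adj-sym)
open import Data.Nat using (ℕ; suc; _≤_; _<_; _+_; z≤n; s≤s)
open import Data.Nat.Properties
  using (≤-reflexive; ≤-trans; ≤-<-trans; <⇒≱; +-mono-≤; +-monoʳ-≤; n≤1+n; +-suc; +-cancelˡ-≤; module ≤-Reasoning)
open import Data.Bool using (Bool; true; false; not; _∧_; _∨_; _xor_; if_then_else_; T?)
open import Data.Bool.Properties using (∨-comm; ∨-assoc; ∨-identityʳ; xor-comm; xor-same; T-not-≡; T-≡; ¬-not)
open import Data.Empty using (⊥)
open import Data.Fin using (Fin)
open import Data.Fin.Properties using (_≟_; any?)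
open import Data.Fin.Subset using (Subset; ∣_∣; _∈_; _∉_; _∪_; ⁅_⁆; inside; outside)
  renaming (⊥ to ∅)
open import Data.Fin.Subset.Properties using (_∈?_; x∈⁅x⁆; x∈p∪q⁺; ∣⊥∣≡0; ∣⁅x⁆∣≡1; p⊆q⇒∣p∣≤∣q∣)
open import Data.List using (List; []; _∷_; length; filterᵇ; _++_)
open import Data.Vec using ([]; _∷_)
open import Data.List.Properties using (length-++; length-filter)
open import Data.List.Membership.Propositional using () renaming (_∈_ to _∈ₗ_)
open import Data.List.Membership.Propositional.Properties using (∈-filter⁻)
import Data.List.Relation.Unary.All.Properties as All
import Data.List.Relation.Unary.Unique.Propositional.Properties as Unique
open import Data.Product using (_×_; _,_; proj₁; proj₂; ∃)
open import Data.Sum using (_⊎_; inj₁; inj₂)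
open import Function using (_∘_; Equivalence)
open import Relation.Binary.PropositionalEquality
open import Relation.Nullary using (¬_; contradiction; Dec; yes; no; ¬?; _×-dec_)
open import Relation.Nullary.Decidable using (⌊_⌋; dec-true; dec-false; isYes≗does; decidable-stable)

private
  variable
    n : ℕ

∣p∪q∣≤∣p∣+∣q∣ : (p q : Subset n) → ∣ p ∪ q ∣ ≤ ∣ p ∣ + ∣ q ∣
∣p∪q∣≤∣p∣+∣q∣ []            []            = z≤n
∣p∪q∣≤∣p∣+∣q∣ (inside  ∷ p) (inside  ∷ q) = s≤s (≤-trans (∣p∪q∣≤∣p∣+∣q∣ p q) (+-monoʳ-≤ ∣ p ∣ (n≤1+n _)))
∣p∪q∣≤∣p∣+∣q∣ (inside  ∷ p) (outside ∷ q) = s≤s (∣p∪q∣≤∣p∣+∣q∣ p q)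
∣p∪q∣≤∣p∣+∣q∣ (outside ∷ p) (inside  ∷ q) = ≤-trans (s≤s (∣p∪q∣≤∣p∣+∣q∣ p q)) (≤-reflexive (sym (+-suc ∣ p ∣ ∣ q ∣)))
∣p∪q∣≤∣p∣+∣q∣ (outside ∷ p) (outside ∷ q) = ∣p∪q∣≤∣p∣+∣q∣ p q

∣q∣<∣p∣⇒∃∈p∉q : {p q : Subset n} → ∣ q ∣ < ∣ p ∣ → ∃ λ x → x ∈ p × x ∉ q
∣q∣<∣p∣⇒∃∈p∉q {p = p} {q} ∣q∣<∣p∣ =
  decidable-stable (any? λ x → (x ∈? p) ×-dec ¬? (x ∈? q)) λ none →
    <⇒≱ ∣q∣<∣p∣ (p⊆q⇒∣p∣≤∣q∣ λ {x} x∈p → decidable-stable (x ∈? q) λ x∉q → none (x , x∈p , x∉q))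

length-filterᵇ-not+length-filterᵇ : ∀ {A : Set} (p : A → Bool) (xs : List A) →
  length (filterᵇ (not ∘ p) xs) + length (filterᵇ p xs) ≡ length xs
length-filterᵇ-not+length-filterᵇ p [] = refl
length-filterᵇ-not+length-filterᵇ p (x ∷ xs) with p x
... | true  = trans (+-suc _ _) (cong suc (length-filterᵇ-not+length-filterᵇ p xs))
... | false = cong suc (length-filterᵇ-not+length-filterᵇ p xs)

joins : Pair n → Fin n → Fin n → Bool
joins p i j = (⌊ proj₁ p ≟ i ⌋ ∧ ⌊ proj₂ p ≟ j ⌋) ∨ (⌊ proj₁ p ≟ j ⌋ ∧ ⌊ proj₂ p ≟ i ⌋)

joins-sound : (p : Pair n) (i j : Fin n) → joins p i j ≡ true → p ≡ (i , j) ⊎ p ≡ (j , i)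
joins-sound (a , c) i j joined with a ≟ i | c ≟ j | a ≟ j | c ≟ i
... | yes refl | yes refl | _        | _        = inj₁ refl
... | _        | _        | yes refl | yes refl = inj₂ refl
joins-sound _ _ _ () | no _  | _     | no _  | _
joins-sound _ _ _ () | no _  | _     | yes _ | no _
joins-sound _ _ _ () | yes _ | no _  | no _  | _
joins-sound _ _ _ () | yes _ | no _  | yes _ | no _

inPairs-sym : (S : PairSet n) (i j : Fin n) → inPairs S i j ≡ inPairs S j i
inPairs-sym []      i j = refl
inPairs-sym (p ∷ S) i j = cong₂ _∨_ (∨-comm (⌊ proj₁ p ≟ i ⌋ ∧ ⌊ proj₂ p ≟ j ⌋) _) (inPairs-sym S i j)

editAdj-sym : (G : Graph n) (S : PairSet n) (i j : Fin n) → editAdj G S i j ≡ editAdj G S j i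
editAdj-sym G S i j = cong₂ _xor_ (adj-sym G i j) (inPairs-sym S i j)

inPairs-++ : (S S′ : PairSet n) (i j : Fin n) → inPairs (S ++ S′) i j ≡ inPairs S i j ∨ inPairs S′ i j
inPairs-++ []      S′ i j = refl
inPairs-++ (p ∷ S) S′ i j = trans (cong (joins p i j ∨_) (inPairs-++ S S′ i j)) (sym (∨-assoc (joins p i j) _ _))

module _ (keep : Pair n → Bool) {i j : Fin n} where

  inPairs-filterᵇ-kept : (∀ p → joins p i j ≡ true → keep p ≡ true) →
    (S : PairSet n) → inPairs (filterᵇ keep S) i j ≡ inPairs S i j
  inPairs-filterᵇ-kept kept []      = refl
  inPairs-filterᵇ-kept kept (p ∷ S) with keep p in kp
  ... | true  = cong (joins p i j ∨_) (inPairs-filterᵇ-kept kept S)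
  ... | false = trans (inPairs-filterᵇ-kept kept S) (sym (cong (_∨ inPairs S i j) unjoined))
    where
    unjoined : joins p i j ≡ false
    unjoined = ¬-not (λ joined → contradiction (trans (sym (kept p joined)) kp) λ ())

  inPairs-filterᵇ-dropped : (∀ p → joins p i j ≡ true → keep p ≡ false) →
    (S : PairSet n) → inPairs (filterᵇ keep S) i j ≡ false
  inPairs-filterᵇ-dropped dropped []      = refl
  inPairs-filterᵇ-dropped dropped (p ∷ S) with keep p in kp
  ... | false = inPairs-filterᵇ-dropped dropped S
  ... | true  = trans (cong (_∨ _) unjoined) (inPairs-filterᵇ-dropped dropped S)
    where
    unjoined : joins p i j ≡ false
    unjoined = ¬-not (λ joined → contradiction (trans (sym kp) (dropped p joined)) λ ())

inside? : Subset n → Fin n → Bool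
inside? X i = ⌊ i ∈? X ⌋

module _ {X : Subset n} {i : Fin n} where

  inside?-∈ : i ∈ X → inside? X i ≡ true
  inside?-∈ i∈X = trans (isYes≗does (i ∈? X)) (dec-true (i ∈? X) i∈X)

  inside?-∉ : i ∉ X → inside? X i ≡ false
  inside?-∉ i∉X = trans (isYes≗does (i ∈? X)) (dec-false (i ∈? X) i∉X)

crossing : Subset n → Pair n → Bool
crossing X p = inside? X (proj₁ p) xor inside? X (proj₂ p)

crossCount≤length : (X : Subset n) (S : PairSet n) → crossCount X S ≤ length S
crossCount≤length X = length-filter (T? ∘ crossing X)

module _ {X : Subset n} {i j : Fin n} (p : Pair n) where

  crossing-joins : joins p i j ≡ true → crossing X p ≡ inside? X i xor inside? X j
  crossing-joins joined with joins-sound p i j joined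
  ... | inj₁ refl = refl
  ... | inj₂ refl = xor-comm (inside? X j) (inside? X i)

  crossing-uncut : inside? X i ≡ inside? X j → joins p i j ≡ true → crossing X p ≡ false
  crossing-uncut same joined =
    trans (crossing-joins joined) (trans (cong (inside? X i xor_) (sym same)) (xor-same (inside? X i)))

  crossing-cut : i ∈ X → j ∉ X → joins p i j ≡ true → crossing X p ≡ true
  crossing-cut i∈X j∉X joined =
    trans (crossing-joins joined) (cong₂ _xor_ (inside?-∈ i∈X) (inside?-∉ j∉X))

innerEnd : Subset n → Pair n → Fin n
innerEnd X p = if inside? X (proj₁ p) then proj₁ p else proj₂ p

innerEnd-joins : {X : Subset n} {x z : Fin n} (p : Pair n) →
  x ∈ X → z ∉ X → joins p x z ≡ true → innerEnd X p ≡ x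
innerEnd-joins {x = x} {z} p x∈X z∉X joined with joins-sound p x z joined
... | inj₁ refl rewrite inside?-∈ x∈X = refl
... | inj₂ refl rewrite inside?-∉ z∉X = refl

crossingEnds : Subset n → PairSet n → Subset n
crossingEnds X []      = ∅
crossingEnds X (p ∷ S) = if crossing X p then ⁅ innerEnd X p ⁆ ∪ crossingEnds X S else crossingEnds X S

∣crossingEnds∣≤crossCount : (X : Subset n) (S : PairSet n) → ∣ crossingEnds X S ∣ ≤ crossCount X S
∣crossingEnds∣≤crossCount {n} X []      = ≤-reflexive (∣⊥∣≡0 n)
∣crossingEnds∣≤crossCount X (p ∷ S) with crossing X p
... | false = ∣crossingEnds∣≤crossCount X S
... | true  = begin
  ∣ ⁅ innerEnd X p ⁆ ∪ crossingEnds X S ∣     ≤⟨ ∣p∪q∣≤∣p∣+∣q∣ ⁅ innerEnd X p ⁆ _ ⟩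
  ∣ ⁅ innerEnd X p ⁆ ∣ + ∣ crossingEnds X S ∣ ≡⟨ cong (_+ _) (∣⁅x⁆∣≡1 (innerEnd X p)) ⟩
  suc ∣ crossingEnds X S ∣                    ≤⟨ s≤s (∣crossingEnds∣≤crossCount X S) ⟩
  suc (crossCount X S)                         ∎
  where open ≤-Reasoning

module _ {X : Subset n} {S : PairSet n} (p : Pair n) where

  innerEnd-∈-crossingEnds : crossing X p ≡ true → innerEnd X p ∈ crossingEnds X (p ∷ S)
  innerEnd-∈-crossingEnds crosses with crossing X p | crosses
  ... | true | _ = x∈p∪q⁺ (inj₁ (x∈⁅x⁆ (innerEnd X p)))

  ∈-crossingEnds-∷ : {x : Fin n} → x ∈ crossingEnds X S → x ∈ crossingEnds X (p ∷ S)
  ∈-crossingEnds-∷ x∈ with crossing X p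
  ... | true  = x∈p∪q⁺ (inj₂ x∈)
  ... | false = x∈

crossed⇒∈crossingEnds : {X : Subset n} {x z : Fin n} → x ∈ X → z ∉ X →
  (S : PairSet n) → inPairs S x z ≡ true → x ∈ crossingEnds X S
crossed⇒∈crossingEnds {X = X} {x} {z} x∈X z∉X (p ∷ S) crossed with joins p x z in joined
... | true  = subst (_∈ crossingEnds X (p ∷ S)) (innerEnd-joins p x∈X z∉X joined)
                (innerEnd-∈-crossingEnds {S = S} p (crossing-cut p x∈X z∉X joined))
... | false = ∈-crossingEnds-∷ {S = S} p (crossed⇒∈crossingEnds x∈X z∉X S crossed)

Uncrossed : PairSet n → Subset n → Fin n → Set
Uncrossed S X x = ∀ z → z ∉ X → inPairs S x z ≡ false

uncrossed-vertex : (X : Subset n) (S T : PairSet n) → crossCount X S + crossCount X T < ∣ X ∣ →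
  ∃ λ x → x ∈ X × Uncrossed S X x × Uncrossed T X x
uncrossed-vertex X S T few with ∣q∣<∣p∣⇒∃∈p∉q {p = X} {q = crossingEnds X S ∪ crossingEnds X T} ends<∣X∣
  where
  ends<∣X∣ : ∣ crossingEnds X S ∪ crossingEnds X T ∣ < ∣ X ∣
  ends<∣X∣ = ≤-<-trans (≤-trans (∣p∪q∣≤∣p∣+∣q∣ (crossingEnds X S) (crossingEnds X T))
    (+-mono-≤ (∣crossingEnds∣≤crossCount X S) (∣crossingEnds∣≤crossCount X T))) few
... | x , x∈X , x∉ends = x , x∈X , uncrossed S (x∉ends ∘ x∈p∪q⁺ ∘ inj₁) , uncrossed T (x∉ends ∘ x∈p∪q⁺ ∘ inj₂)
  where
  uncrossed : (R : PairSet _) → x ∉ crossingEnds X R → Uncrossed R X x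
  uncrossed R x∉ z z∉X = ¬-not (x∉ ∘ crossed⇒∈crossingEnds x∈X z∉X R)

InducedP4 : (Fin n → Fin n → Bool) → Fin n → Fin n → Fin n → Fin n → Set
InducedP4 A a b c d =
  A a b ≡ true × A b c ≡ true × A c d ≡ true × A a c ≡ false × A b d ≡ false × A a d ≡ false

InducedP4-transport : (A B : Fin n → Fin n → Bool) {a b c d a′ b′ c′ d′ : Fin n} →
  A a b ≡ B a′ b′ → A b c ≡ B b′ c′ → A c d ≡ B c′ d′ →
  A a c ≡ B a′ c′ → A b d ≡ B b′ d′ → A a d ≡ B a′ d′ →
  InducedP4 A a b c d → InducedP4 B a′ b′ c′ d′
InducedP4-transport A B ab bc cd ac bd ad (ab′ , bc′ , cd′ , ac′ , bd′ , ad′) =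
  trans (sym ab) ab′ , trans (sym bc) bc′ , trans (sym cd) cd′ ,
  trans (sym ac) ac′ , trans (sym bd) bd′ , trans (sym ad) ad′

IsCograph-resp-≗ : {A B : Fin n → Fin n → Bool} → (∀ i j → A i j ≡ B i j) → IsCograph B → IsCograph A
IsCograph-resp-≗ {A = A} {B} A≗B cograph a b c d a≢b a≢c a≢d b≢c b≢d c≢d =
  cograph a b c d a≢b a≢c a≢d b≢c b≢d c≢d
    ∘ InducedP4-transport A B (A≗B a b) (A≗B b c) (A≗B c d) (A≗B a c) (A≗B b d) (A≗B a d)

module Substitution (A : Fin n → Fin n → Bool) (X : Subset n) (x : Fin n) where

  opaque
    substitute : Fin n → Fin n → Bool
    substitute i j =
      if inside? X i then (if inside? X j then A i j else A x j)
                     else (if inside? X j then A i x else A i j)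

    substitute-∈∈ : {i j : Fin n} → i ∈ X → j ∈ X → substitute i j ≡ A i j
    substitute-∈∈ i∈X j∈X rewrite inside?-∈ i∈X | inside?-∈ j∈X = refl

    substitute-∈∉ : {i j : Fin n} → i ∈ X → j ∉ X → substitute i j ≡ A x j
    substitute-∈∉ i∈X j∉X rewrite inside?-∈ i∈X | inside?-∉ j∉X = refl

    substitute-∉∈ : {i j : Fin n} → i ∉ X → j ∈ X → substitute i j ≡ A i x
    substitute-∉∈ i∉X j∈X rewrite inside?-∉ i∉X | inside?-∈ j∈X = refl

    substitute-∉∉ : {i j : Fin n} → i ∉ X → j ∉ X → substitute i j ≡ A i j
    substitute-∉∉ i∉X j∉X rewrite inside?-∉ i∉X | inside?-∉ j∉X = refl

  substitute-isModule : IsModule substitute X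
  substitute-isModule y y′ z y∈X y′∈X z∉X = trans (substitute-∈∉ y∈X z∉X) (sym (substitute-∈∉ y′∈X z∉X))

  substitute-sym : (∀ i j → A i j ≡ A j i) → ∀ i j → substitute i j ≡ substitute j i
  substitute-sym A-sym i j = by-cases (i ∈? X) (j ∈? X)
    where
    by-cases : Dec (i ∈ X) → Dec (j ∈ X) → substitute i j ≡ substitute j i
    by-cases (yes i∈X) (yes j∈X) = trans (substitute-∈∈ i∈X j∈X) (trans (A-sym i j) (sym (substitute-∈∈ j∈X i∈X)))
    by-cases (yes i∈X) (no  j∉X) = trans (substitute-∈∉ i∈X j∉X) (trans (A-sym x j) (sym (substitute-∉∈ j∉X i∈X)))
    by-cases (no  i∉X) (yes j∈X) = trans (substitute-∉∈ i∉X j∈X) (trans (A-sym i x) (sym (substitute-∈∉ j∈X i∉X)))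
    by-cases (no  i∉X) (no  j∉X) = trans (substitute-∉∉ i∉X j∉X) (trans (A-sym i j) (sym (substitute-∉∉ j∉X i∉X)))

  substitute-preserves-cograph : (∀ i j → A i j ≡ A j i) → x ∈ X → IsCograph A → IsCograph substitute
  substitute-preserves-cograph A-sym x∈X cograph a b c d a≢b a≢c a≢d b≢c b≢d c≢d p4@(ab , bc , cd , ac , bd , ad) =
    by-cases (a ∈? X) (b ∈? X) (c ∈? X) (d ∈? X)
    where
    ¬distinguished : ∀ {y y′ z} → y ∈ X → y′ ∈ X → z ∉ X → substitute y z ≡ true → substitute y′ z ≡ false → ⊥
    ¬distinguished y∈X y′∈X z∉X yz y′z =
      contradiction (trans (sym yz) (trans (substitute-isModule _ _ _ y∈X y′∈X z∉X) y′z)) λ ()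

    flip : ∀ i j {v} → substitute i j ≡ v → substitute j i ≡ v
    flip i j = trans (substitute-sym A-sym j i)

    x≢ : ∀ {w} → w ∉ X → x ≢ w
    x≢ w∉X refl = w∉X x∈X

    ≢x : ∀ {w} → w ∉ X → w ≢ x
    ≢x w∉X refl = w∉X x∈X

    by-cases : Dec (a ∈ X) → Dec (b ∈ X) → Dec (c ∈ X) → Dec (d ∈ X) → ⊥
    by-cases (yes a∈) (yes b∈) (yes c∈) (yes d∈) = cograph a b c d a≢b a≢c a≢d b≢c b≢d c≢d (InducedP4-transport substitute A
      (substitute-∈∈ a∈ b∈) (substitute-∈∈ b∈ c∈) (substitute-∈∈ c∈ d∈)
      (substitute-∈∈ a∈ c∈) (substitute-∈∈ b∈ d∈) (substitute-∈∈ a∈ d∈) p4)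
    by-cases (no a∉) (no b∉) (no c∉) (no d∉) = cograph a b c d a≢b a≢c a≢d b≢c b≢d c≢d (InducedP4-transport substitute A
      (substitute-∉∉ a∉ b∉) (substitute-∉∉ b∉ c∉) (substitute-∉∉ c∉ d∉)
      (substitute-∉∉ a∉ c∉) (substitute-∉∉ b∉ d∉) (substitute-∉∉ a∉ d∉) p4)
    by-cases (yes a∈) (no b∉) (no c∉) (no d∉) = cograph x b c d (x≢ b∉) (x≢ c∉) (x≢ d∉) b≢c b≢d c≢d (InducedP4-transport substitute A
      (substitute-∈∉ a∈ b∉) (substitute-∉∉ b∉ c∉) (substitute-∉∉ c∉ d∉)
      (substitute-∈∉ a∈ c∉) (substitute-∉∉ b∉ d∉) (substitute-∈∉ a∈ d∉) p4)
    by-cases (no a∉) (yes b∈) (no c∉) (no d∉) = cograph a x c d (≢x a∉) a≢c a≢d (x≢ c∉) (x≢ d∉) c≢d (InducedP4-transport substitute A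
      (substitute-∉∈ a∉ b∈) (substitute-∈∉ b∈ c∉) (substitute-∉∉ c∉ d∉)
      (substitute-∉∉ a∉ c∉) (substitute-∈∉ b∈ d∉) (substitute-∉∉ a∉ d∉) p4)
    by-cases (no a∉) (no b∉) (yes c∈) (no d∉) = cograph a b x d a≢b (≢x a∉) a≢d (≢x b∉) b≢d (x≢ d∉) (InducedP4-transport substitute A
      (substitute-∉∉ a∉ b∉) (substitute-∉∈ b∉ c∈) (substitute-∈∉ c∈ d∉)
      (substitute-∉∈ a∉ c∈) (substitute-∉∉ b∉ d∉) (substitute-∉∉ a∉ d∉) p4)
    by-cases (no a∉) (no b∉) (no c∉) (yes d∈) = cograph a b c x a≢b a≢c (≢x a∉) b≢c (≢x b∉) (≢x c∉) (InducedP4-transport substitute A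
      (substitute-∉∉ a∉ b∉) (substitute-∉∉ b∉ c∉) (substitute-∉∈ c∉ d∈)
      (substitute-∉∉ a∉ c∉) (substitute-∉∈ b∉ d∈) (substitute-∉∈ a∉ d∈) p4)
    by-cases (yes a∈) (yes b∈) (no c∉) _       = ¬distinguished b∈ a∈ c∉ bc ac
    by-cases (yes a∈) _       (yes c∈) (no d∉) = ¬distinguished c∈ a∈ d∉ cd ad
    by-cases (yes a∈) (no b∉) _       (yes d∈) = ¬distinguished a∈ d∈ b∉ ab (flip b d bd)
    by-cases (no a∉) (yes b∈) (yes c∈) _       = ¬distinguished b∈ c∈ a∉ (flip a b ab) (flip a c ac)
    by-cases (no a∉) (yes b∈) (no c∉) (yes d∈) = ¬distinguished b∈ d∈ a∉ (flip a b ab) (flip a d ad)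
    by-cases (no a∉) (no b∉) (yes c∈) (yes d∈) = ¬distinguished c∈ d∈ b∉ (flip b c bc) (flip b d bd)

exchange : Subset n → PairSet n → PairSet n → PairSet n
exchange X S T = filterᵇ (not ∘ crossing X) S ++ filterᵇ (crossing X) T

exchange-valid : (X : Subset n) {S T : PairSet n} → ValidPairSet S → ValidPairSet T → ValidPairSet (exchange X S T)
exchange-valid X {S} {T} (S-ordered , S-unique) (T-ordered , T-unique) =
  All.++⁺ (All.filter⁺ (T? ∘ not ∘ crossing X) S-ordered) (All.filter⁺ (T? ∘ crossing X) T-ordered) ,
  Unique.++⁺ (Unique.filter⁺ (T? ∘ not ∘ crossing X) {S} S-unique) (Unique.filter⁺ (T? ∘ crossing X) {T} T-unique) disjoint
  where
  disjoint : ∀ {p} → ¬ (p ∈ₗ filterᵇ (not ∘ crossing X) S × p ∈ₗ filterᵇ (crossing X) T)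
  disjoint (p∈S , p∈T) = contradiction
    (trans (sym (Equivalence.to T-not-≡ (proj₂ (∈-filter⁻ (T? ∘ not ∘ crossing X) {xs = S} p∈S))))
           (Equivalence.to T-≡ (proj₂ (∈-filter⁻ (T? ∘ crossing X) {xs = T} p∈T))))
    λ ()

crossCount-exchange : (X : Subset n) (S T : PairSet n) →
  length S ≤ length (exchange X S T) → crossCount X S ≤ crossCount X T
crossCount-exchange X S T S≤exchange = +-cancelˡ-≤ (length kept) _ _ (begin
  length kept + crossCount X S    ≡⟨ length-filterᵇ-not+length-filterᵇ (crossing X) S ⟩
  length S                        ≤⟨ S≤exchange ⟩
  length (exchange X S T)         ≡⟨ length-++ kept ⟩
  length kept + crossCount X T    ∎)
  where
  open ≤-Reasoning
  kept : PairSet _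
  kept = filterᵇ (not ∘ crossing X) S

module _ {X : Subset n} (S T : PairSet n) {i j : Fin n} where

  inPairs-exchange-uncut : inside? X i ≡ inside? X j → inPairs (exchange X S T) i j ≡ inPairs S i j
  inPairs-exchange-uncut same = begin
    inPairs (exchange X S T) i j
      ≡⟨ inPairs-++ (filterᵇ (not ∘ crossing X) S) _ i j ⟩
    inPairs (filterᵇ (not ∘ crossing X) S) i j ∨ inPairs (filterᵇ (crossing X) T) i j
      ≡⟨ cong₂ _∨_ (inPairs-filterᵇ-kept (not ∘ crossing X) (λ p → cong not ∘ crossing-uncut p same) S)
                   (inPairs-filterᵇ-dropped (crossing X) (λ p → crossing-uncut p same) T) ⟩
    inPairs S i j ∨ false
      ≡⟨ ∨-identityʳ _ ⟩
    inPairs S i j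
      ∎
    where open ≡-Reasoning

  inPairs-exchange-cut : i ∈ X → j ∉ X → inPairs (exchange X S T) i j ≡ inPairs T i j
  inPairs-exchange-cut i∈X j∉X = begin
    inPairs (exchange X S T) i j
      ≡⟨ inPairs-++ (filterᵇ (not ∘ crossing X) S) _ i j ⟩
    inPairs (filterᵇ (not ∘ crossing X) S) i j ∨ inPairs (filterᵇ (crossing X) T) i j
      ≡⟨ cong₂ _∨_ (inPairs-filterᵇ-dropped (not ∘ crossing X) (λ p → cong not ∘ crossing-cut p i∈X j∉X) S)
                   (inPairs-filterᵇ-kept (crossing X) (λ p → crossing-cut p i∈X j∉X) T) ⟩
    false ∨ inPairs T i j
      ≡⟨⟩
    inPairs T i j
      ∎
    where open ≡-Reasoning

exchange-≗-substitute : (G : Graph n) {X : Subset n} {x : Fin n} (S T : PairSet n) →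
  IsModule (editAdj G T) X → x ∈ X → Uncrossed S X x → Uncrossed T X x →
  ∀ i j → editAdj G (exchange X S T) i j ≡ Substitution.substitute (editAdj G S) X x i j
exchange-≗-substitute G {X} {x} S T T-module x∈X S-uncrossed T-uncrossed i j = by-cases (i ∈? X) (j ∈? X)
  where
  open Substitution (editAdj G S) X x

  uncut : ∀ {i j} → inside? X i ≡ inside? X j → editAdj G (exchange X S T) i j ≡ editAdj G S i j
  uncut {i} {j} same = cong (adj G i j xor_) (inPairs-exchange-uncut S T same)

  cut : ∀ {i j} → i ∈ X → j ∉ X → editAdj G (exchange X S T) i j ≡ substitute i j
  cut {i} {j} i∈X j∉X = begin
    editAdj G (exchange X S T) i j  ≡⟨ cong (adj G i j xor_) (inPairs-exchange-cut S T i∈X j∉X) ⟩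
    editAdj G T i j                 ≡⟨ T-module i x j i∈X x∈X j∉X ⟩
    editAdj G T x j                 ≡⟨ cong (adj G x j xor_) (trans (T-uncrossed j j∉X) (sym (S-uncrossed j j∉X))) ⟩
    editAdj G S x j                 ≡⟨ sym (substitute-∈∉ i∈X j∉X) ⟩
    substitute i j                  ∎
    where open ≡-Reasoning

  by-cases : Dec (i ∈ X) → Dec (j ∈ X) → editAdj G (exchange X S T) i j ≡ substitute i j
  by-cases (yes i∈X) (yes j∈X) =
    trans (uncut (trans (inside?-∈ i∈X) (sym (inside?-∈ j∈X)))) (sym (substitute-∈∈ i∈X j∈X))
  by-cases (no  i∉X) (no  j∉X) =
    trans (uncut (trans (inside?-∉ i∉X) (sym (inside?-∉ j∉X)))) (sym (substitute-∉∉ i∉X j∉X))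
  by-cases (yes i∈X) (no  j∉X) = cut i∈X j∉X
  by-cases (no  i∉X) (yes j∈X) =
    trans (editAdj-sym G (exchange X S T) i j) (trans (cut j∈X i∉X) (substitute-sym (editAdj-sym G S) j i))

lemma2 : ∀ {n} (G : Graph n) (k t : ℕ) (X : Subset n) →
    IsTModule G t X → k + t < ∣ X ∣ →
    (∃ λ S → IsCographEdit G S × length S ≤ k) →
    BudgetAtMost G X t
lemma2 G k t X (T , T-valid , ∣T∣≤t , T-module) k+t<∣X∣ (S , S-edit , ∣S∣≤k) S′ ((S′-valid , S′-cograph) , S′-minimum)
  with uncrossed-vertex X S′ T few-crossings
  where
  few-crossings : crossCount X S′ + crossCount X T < ∣ X ∣
  few-crossings = ≤-<-trans
    (+-mono-≤ (≤-trans (crossCount≤length X S′) (≤-trans (S′-minimum S S-edit) ∣S∣≤k))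
              (≤-trans (crossCount≤length X T) ∣T∣≤t))
    k+t<∣X∣
... | x , x∈X , S′-uncrossed , T-uncrossed =
  ≤-trans (crossCount-exchange X S′ T (S′-minimum (exchange X S′ T) exchange-edit))
          (≤-trans (crossCount≤length X T) ∣T∣≤t)
  where
  open Substitution (editAdj G S′) X x

  exchange-edit : IsCographEdit G (exchange X S′ T)
  exchange-edit = exchange-valid X S′-valid T-valid ,
    IsCograph-resp-≗ (exchange-≗-substitute G S′ T T-module x∈X S′-uncrossed T-uncrossed)
                     (substitute-preserves-cograph (editAdj-sym G S′) x∈X S′-cograph)
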